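{- Let $S$ be the set of positive integers congruent to $1$ modulo $3$, and for $i\ge0$ let $S_i$ be the set of the smallest $i+1$ elements of $S$. Then the Nim sequence of $S_i$ is $\big(01(012)^i\big)^\omega$, and the Nim sequence of $S$ is $01(012)^\omega$.
   Context: For a set $S$ of positive integers, $\mathrm{SG}_S(n)=\mathrm{mex}\{\mathrm{SG}_S(n-s)\mid s\in S,s\le n\}$ ($\mathrm{mex}$ = least nonnegative integer not in the set), and the Nim sequence of $S$ is the word $(\mathrm{SG}_S(n))_{n\ge0}$. $u^i$ is $u$ repeated $i$ times and $u^\omega$ is $u$ repeated infinitely often. -}

module Defs where

open import Data.Nat using (ℕ; zero; suc; _+_; _*_; _∸_; _≡ᵇ_; _≤ᵇ_; NonZero)
open import Data.Nat.DivMod using (_%_)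
open import Data.Bool using (Bool; true; false; if_then_else_; _∧_)
open import Data.List using (List; []; _∷_; length; _++_)
open import Data.Bool.ListAction using (any)

Subset : Set
Subset = ℕ → Bool

-- total list lookup (default 0 when out of range; only used in-range below)
at : List ℕ → ℕ → ℕ
at []       _       = 0
at (x ∷ xs) zero    = x
at (x ∷ xs) (suc k) = at xs k

elem : ℕ → List ℕ → Bool
elem k xs = any (λ x → k ≡ᵇ x) xs

-- mex: least natural number not in the list (search is bounded by the length, which suffices)
mexAux : ℕ → ℕ → List ℕ → ℕ
mexAux zero    k xs = k
mexAux (suc f) k xs = if elem k xs then mexAux f (suc k) xs else k

mex : List ℕ → ℕ
mex xs = mexAux (length xs) 0 xs

-- options at position n given prev = [SG(n-1), ..., SG(0)]:
-- the list of SG(n - s) for s = 1..n with s ∈ S (prev at index s-1 is SG(n-s)).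
options : Subset → List ℕ → ℕ → List ℕ → List ℕ
options S prev s []       = []
options S prev s (_ ∷ rest) =
  (if S (suc s) then at prev s ∷ [] else []) ++ options S prev (suc s) rest

-- sgRev S n = [SG_S(n-1), ..., SG_S(0)]
sgRev : Subset → ℕ → List ℕ
sgRev S zero    = []
sgRev S (suc n) = mex (options S (sgRev S n) 0 (sgRev S n)) ∷ sgRev S n

SG : Subset → ℕ → ℕ
SG S n = at (sgRev S (suc n)) 0

NimSeq : Subset → ℕ → ℕ
NimSeq S = SG S

_^_ : List ℕ → ℕ → List ℕ
u ^ zero  = []
u ^ suc i = u ++ (u ^ i)

_^ω : (u : List ℕ) → .{{NonZero (length u)}} → ℕ → ℕ
(u ^ω) n = at u (n % length u)

_·_^ω : List ℕ → (v : List ℕ) → .{{NonZero (length v)}} → ℕ → ℕ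
(u · v ^ω) n = if suc n ≤ᵇ length u then at u n else (v ^ω) (n ∸ length u)

S : Subset
S n = (n % 3) ≡ᵇ 1

Sᵢ : ℕ → Subset
Sᵢ i n = S n ∧ (n ≤ᵇ 3 * i + 1)

-- A function g is the Sprague–Grundy function of a subtraction set exactly when from every
-- position n some move reaches each value below g n and no move reaches g n itself.  The
-- moves of S = {1, 4, 7, …} have length ≡ 1 (mod 3), so on the tail (0 1 2)^ω of
-- 0 1 (0 1 2)^ω they never preserve the value, and the values 1 and 2 are reached by one
-- step back and by a jump to position 0.  For Sᵢ the longest move 3i + 1 is one less than
-- the period 3i + 2 of (0 1 (0 1 2)^i)^ω, so a move that wraps around the period is, read
-- backwards inside one block, again a move of length ≡ 1 (mod 3).
module Submission where

open import Defs
open import Data.Bool using (true; false; T)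
open import Data.Bool.Properties using (T-∧; T-≡)
open import Data.Fin using (toℕ)
open import Data.Fin.Properties using (pigeonhole; toℕ≤pred[n])
open import Data.List using (List; []; _∷_; length; applyDownFrom)
open import Data.List.Membership.Propositional using (_∈_; _∉_)
open import Data.List.Membership.Propositional.Properties using (∈-++⁺ʳ)
open import Data.List.Membership.Setoid.Properties using (index-injective)
open import Data.List.Properties using (length-++; length-applyDownFrom)
open import Data.List.Relation.Unary.Any using (here; there; index)
import Data.List.Relation.Unary.Any as Any
open import Data.List.Relation.Unary.Any.Properties using (any⁺; any⁻)
open import Data.Nat using (ℕ; zero; suc; _+_; _*_; _∸_; _≤_; _<_; z≤n; s≤s; NonZero)
open import Data.Nat.DivMod
open import Data.Nat.Divisibility using (_∣_; divides; _∣0; m∣m*n; ∣m+n∣m⇒∣n; m%n≡0⇒n∣m)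
open import Data.Nat.Properties
open import Data.Product using (_×_; _,_; ∃₂; ∃-syntax)
open import Data.Sum using (_⊎_; inj₁; inj₂)
open import Function using (_∘_; _⇔_; mk⇔; Equivalence)
open import Relation.Binary.Definitions using (tri<; tri≈; tri>)
open import Relation.Binary.PropositionalEquality
open import Relation.Nullary using (¬_; contradiction; yes; no)

open Equivalence using (to; from)

∈⇒elem : ∀ {k xs} → k ∈ xs → T (elem k xs)
∈⇒elem {k} = any⁺ _ ∘ Any.map (≡⇒≡ᵇ k _)

elem⇒∈ : ∀ {k} xs → T (elem k xs) → k ∈ xs
elem⇒∈ {k} xs = Any.map (≡ᵇ⇒≡ k _) ∘ any⁻ _ xs

¬[0,length]⊆ : ∀ xs → ¬ (∀ j → j ≤ length xs → j ∈ xs)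
¬[0,length]⊆ xs covered
  with i , j , i<j , same-index ← pigeonhole ≤-refl (λ j → index (covered (toℕ j) (toℕ≤pred[n] j)))
  = <-irrefl (index-injective (setoid ℕ) (covered _ _) (covered _ _) same-index) i<j

mexAux-below : ∀ f k xs j → k ≤ j → j < mexAux f k xs → j ∈ xs
mexAux-below zero    k xs j k≤j j<k = contradiction j<k (≤⇒≯ k≤j)
mexAux-below (suc f) k xs j k≤j j<mex with elem k xs in k∈
... | false = contradiction j<mex (≤⇒≯ k≤j)
... | true with k ≟ j
...   | yes refl = elem⇒∈ xs (subst T (sym k∈) _)
...   | no k≢j   = mexAux-below f (suc k) xs j (≤∧≢⇒< k≤j k≢j) j<mex

-- The fuel length xs suffices: once it runs out, 0, …, length xs − 1 all lie in xs,
-- so length xs does not.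
mexAux-∉ : ∀ f k xs → k + f ≡ length xs → (∀ j → j < k → j ∈ xs) → mexAux f k xs ∉ xs
mexAux-∉ zero k xs k+0≡len below k∈ = ¬[0,length]⊆ xs covered
  where
  k≡len : k ≡ length xs
  k≡len = trans (sym (+-identityʳ k)) k+0≡len
  covered : ∀ j → j ≤ length xs → j ∈ xs
  covered j j≤len with m≤n⇒m<n∨m≡n j≤len
  ... | inj₁ j<len = below j (subst (j <_) (sym k≡len) j<len)
  ... | inj₂ refl  = subst (_∈ xs) k≡len k∈
mexAux-∉ (suc f) k xs k+f≡len below with elem k xs in k∈
... | false = λ k∈xs → subst T k∈ (∈⇒elem k∈xs)
... | true  = mexAux-∉ f (suc k) xs (trans (sym (+-suc k f)) k+f≡len) below′
  where
  below′ : ∀ j → j < suc k → j ∈ xs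
  below′ j j<1+k with m≤n⇒m<n∨m≡n (≤-pred j<1+k)
  ... | inj₁ j<k = below j j<k
  ... | inj₂ refl = elem⇒∈ xs (subst T (sym k∈) _)

mex-unique : ∀ xs m → (∀ j → j < m → j ∈ xs) → m ∉ xs → mex xs ≡ m
mex-unique xs m below m∉ with <-cmp (mex xs) m
... | tri< mex<m _ _ = contradiction (below _ mex<m) (mexAux-∉ (length xs) 0 xs refl (λ _ ()))
... | tri≈ _ mex≡m _ = mex≡m
... | tri> _ _ m<mex = contradiction (mexAux-below (length xs) 0 xs m z≤n m<mex) m∉

∈-options⁻ : ∀ S prev s rest {k} → k ∈ options S prev s rest →
             ∃[ t ] t < s + length rest × T (S (suc t)) × at prev t ≡ k
∈-options⁻ S prev s (_ ∷ rest) k∈ rewrite +-suc s (length rest) with S (suc s) in s∈S | k∈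
... | true  | here refl = s , s≤s (m≤m+n s (length rest)) , subst T (sym s∈S) _ , refl
... | true  | there k∈′ = ∈-options⁻ S prev (suc s) rest k∈′
... | false | k∈′       = ∈-options⁻ S prev (suc s) rest k∈′

∈-options⁺ : ∀ S prev s rest t → s ≤ t → t < s + length rest → T (S (suc t)) →
             at prev t ∈ options S prev s rest
∈-options⁺ S prev s []         t s≤t t< _ = contradiction (subst (t <_) (+-identityʳ s) t<) (≤⇒≯ s≤t)
∈-options⁺ S prev s (_ ∷ rest) t s≤t t< t∈S with s ≟ t
... | yes refl rewrite to T-≡ t∈S = here refl
... | no s≢t = ∈-++⁺ʳ _ (∈-options⁺ S prev (suc s) rest t (≤∧≢⇒< s≤t s≢t)
                                    (subst (t <_) (+-suc s (length rest)) t<) t∈S)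

at-applyDownFrom : ∀ (g : ℕ → ℕ) n s → s < n → at (applyDownFrom g n) s ≡ g (n ∸ suc s)
at-applyDownFrom g (suc n) zero    _         = refl
at-applyDownFrom g (suc n) (suc s) (s≤s s<n) = at-applyDownFrom g n s s<n

Covers : Subset → (ℕ → ℕ) → Set
Covers S g = ∀ n k → k < g n → ∃₂ λ m s → m + suc s ≡ n × T (S (suc s)) × g m ≡ k

Avoids : Subset → (ℕ → ℕ) → Set
Avoids S g = ∀ m s → T (S (suc s)) → g (m + suc s) ≢ g m

sgRev≡applyDownFrom : ∀ S g → Covers S g → Avoids S g → ∀ n → sgRev S n ≡ applyDownFrom g n
sgRev≡applyDownFrom S g covers avoids zero = refl
sgRev≡applyDownFrom S g covers avoids (suc n) rewrite sgRev≡applyDownFrom S g covers avoids n =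
  cong (_∷ prev) (mex-unique (options S prev 0 prev) (g n) reached g[n]∉)
  where
  prev : List ℕ
  prev = applyDownFrom g n

  reached : ∀ k → k < g n → k ∈ options S prev 0 prev
  reached k k<gn with m , s , m+1+s≡n , s∈S , gm≡k ← covers n k k<gn =
    subst (_∈ options S prev 0 prev) at≡k
      (∈-options⁺ S prev 0 prev s z≤n (subst (s <_) (sym (length-applyDownFrom g n)) s<n) s∈S)
    where
    s<n : s < n
    s<n = subst (s <_) m+1+s≡n (m≤n+m (suc s) m)
    at≡k : at prev s ≡ k
    at≡k = begin
      at prev s             ≡⟨ at-applyDownFrom g n s s<n ⟩
      g (n ∸ suc s)         ≡⟨ cong (λ n → g (n ∸ suc s)) (sym m+1+s≡n) ⟩
      g (m + suc s ∸ suc s) ≡⟨ cong g (m+n∸n≡m m (suc s)) ⟩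
      g m                   ≡⟨ gm≡k ⟩
      k                     ∎
      where open ≡-Reasoning

  g[n]∉ : g n ∉ options S prev 0 prev
  g[n]∉ gn∈ with t , t<len , t∈S , at≡gn ← ∈-options⁻ S prev 0 prev gn∈ =
    avoids (n ∸ suc t) t t∈S (begin
      g (n ∸ suc t + suc t) ≡⟨ cong g (m∸n+n≡m t<n) ⟩
      g n                   ≡⟨ sym at≡gn ⟩
      at prev t             ≡⟨ at-applyDownFrom g n t t<n ⟩
      g (n ∸ suc t)         ∎)
    where
    open ≡-Reasoning
    t<n : t < n
    t<n = subst (t <_) (length-applyDownFrom g n) t<len

SG-unique : ∀ S g → Covers S g → Avoids S g → SG S ≗ g
SG-unique S g covers avoids n = cong (λ l → at l 0) (sgRev≡applyDownFrom S g covers avoids (suc n))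

[1+m]%3-cases : ∀ m → (m % 3 ≡ 0 × suc m % 3 ≡ 1) ⊎ (m % 3 ≡ 1 × suc m % 3 ≡ 2) ⊎ (m % 3 ≡ 2 × suc m % 3 ≡ 0)
[1+m]%3-cases m with m % 3 | m%n<n m 3 | %-distribˡ-+ 1 m 3
... | 0 | _ | eq = inj₁ (refl , eq)
... | 1 | _ | eq = inj₂ (inj₁ (refl , eq))
... | 2 | _ | eq = inj₂ (inj₂ (refl , eq))
... | suc (suc (suc _)) | s≤s (s≤s (s≤s ())) | _

[1+m]%3≢m%3 : ∀ m → suc m % 3 ≢ m % 3
[1+m]%3≢m%3 m with [1+m]%3-cases m
... | inj₁ (r , r′)        = λ eq → 0≢1+n (trans (sym r) (trans (sym eq) r′))
... | inj₂ (inj₁ (r , r′)) = λ eq → 1+n≢n (trans (sym r′) (trans eq r))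
... | inj₂ (inj₂ (r , r′)) = λ eq → 0≢1+n (trans (sym r′) (trans eq r))

[1+m]%3≡1+k⇒m%3≡k : ∀ m {k} → suc m % 3 ≡ suc k → m % 3 ≡ k
[1+m]%3≡1+k⇒m%3≡k m eq with [1+m]%3-cases m
... | inj₁ (r , r′)        = trans r (suc-injective (trans (sym r′) eq))
... | inj₂ (inj₁ (r , r′)) = trans r (suc-injective (trans (sym r′) eq))
... | inj₂ (inj₂ (r , r′)) = contradiction (trans (sym r′) eq) 0≢1+n

m%3≡2⇒[1+m]%3≡0 : ∀ m → m % 3 ≡ 2 → suc m % 3 ≡ 0
m%3≡2⇒[1+m]%3≡0 m r with [1+m]%3-cases m
... | inj₁ (r₀ , _)        = contradiction (trans (sym r₀) r) 0≢1+n
... | inj₂ (inj₁ (r₁ , _)) = contradiction (suc-injective (trans (sym r₁) r)) 0≢1+n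
... | inj₂ (inj₂ (_ , r′)) = r′

nimS : ℕ → ℕ
nimS 0             = 0
nimS 1             = 1
nimS (suc (suc m)) = m % 3

nimS-pred : ∀ n {k} → nimS (suc n) ≡ suc k → nimS n ≡ k
nimS-pred 0             refl = refl
nimS-pred 1             ()
nimS-pred (suc (suc m)) eq   = [1+m]%3≡1+k⇒m%3≡k m eq

nimS≡2⇒3∣ : ∀ s → nimS (suc s) ≡ 2 → 3 ∣ s
nimS≡2⇒3∣ (suc s) eq = m%n≡0⇒n∣m (suc s) 3 (m%3≡2⇒[1+m]%3≡0 s eq)

nimS<3 : ∀ n → nimS n < 3
nimS<3 0             = s≤s z≤n
nimS<3 1             = s≤s (s≤s z≤n)
nimS<3 (suc (suc m)) = m%n<n m 3

nimS-covers : ∀ n k → k < nimS n → ∃₂ λ m s → m + suc s ≡ n × 3 ∣ s × nimS m ≡ k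
nimS-covers (suc n) k k< with nimS (suc n) in v | nimS<3 (suc n)
nimS-covers (suc n) 0             _                | 1 | _ = n , 0 , +-comm n 1 , 3 ∣0 , nimS-pred n v
nimS-covers (suc n) 0             _                | 2 | _ = 0 , n , refl , nimS≡2⇒3∣ n v , refl
nimS-covers (suc n) 1             _                | 2 | _ = n , 0 , +-comm n 1 , 3 ∣0 , nimS-pred n v
nimS-covers (suc n) (suc _)       (s≤s ())         | 1 | _
nimS-covers (suc n) (suc (suc _)) (s≤s (s≤s ()))   | 2 | _
nimS-covers (suc n) _             _                | suc (suc (suc _)) | s≤s (s≤s (s≤s ()))

nimS-avoids : ∀ m {d} → 3 ∣ d → nimS (m + suc d) ≢ nimS m
nimS-avoids 0             {d = 0} _            ()
nimS-avoids 0             (divides (suc q) refl) eq = 0≢1+n (sym (trans (sym ([m+kn]%n≡m%n 2 q 3)) eq))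
nimS-avoids 1             (divides q refl)       eq = 0≢1+n (trans (sym (m*n%n≡0 q 3)) eq)
nimS-avoids (suc (suc m)) (divides q refl)       eq = [1+m]%3≢m%3 m (begin
  suc m % 3             ≡⟨ sym ([m+kn]%n≡m%n (suc m) q 3) ⟩
  (suc m + q * 3) % 3   ≡⟨ cong (_% 3) (sym (+-suc m (q * 3))) ⟩
  (m + suc (q * 3)) % 3 ≡⟨ eq ⟩
  m % 3                 ∎)
  where open ≡-Reasoning

at-012^ : ∀ i r → r < 3 * i → at ((0 ∷ 1 ∷ 2 ∷ []) ^ i) r ≡ r % 3
at-012^ (suc i) 0 _ = refl
at-012^ (suc i) 1 _ = refl
at-012^ (suc i) 2 _ = refl
at-012^ (suc i) (suc (suc (suc r))) r< = begin
  at ((0 ∷ 1 ∷ 2 ∷ []) ^ i) r ≡⟨ at-012^ i r (≤-pred (≤-pred (≤-pred (subst (3 + r <_) (*-suc 3 i) r<)))) ⟩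
  r % 3                       ≡⟨ sym ([m+n]%n≡m%n r 3) ⟩
  (r + 3) % 3                 ≡⟨ cong (_% 3) (+-comm r 3) ⟩
  (3 + r) % 3                 ∎
  where open ≡-Reasoning

nimS-word : ∀ n → nimS n ≡ ((0 ∷ 1 ∷ []) · (0 ∷ 1 ∷ 2 ∷ []) ^ω) n
nimS-word 0             = refl
nimS-word 1             = refl
nimS-word (suc (suc m)) = sym (trans (at-012^ 1 (m % 3) (m%n<n m 3)) (m%n%n≡m%n m 3))

T-S-suc⇔3∣ : ∀ s → T (S (suc s)) ⇔ 3 ∣ s
T-S-suc⇔3∣ s = mk⇔
  (λ s∈S → m%n≡0⇒n∣m s 3 ([1+m]%3≡1+k⇒m%3≡k s (≡ᵇ⇒≡ _ 1 s∈S)))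
  (λ { (divides q refl) → ≡⇒≡ᵇ _ 1 ([m+kn]%n≡m%n 1 q 3) })

S-covers : Covers S nimS
S-covers n k k< with m , s , m+1+s≡n , 3∣s , nimS[m]≡k ← nimS-covers n k k< =
  m , s , m+1+s≡n , from (T-S-suc⇔3∣ s) 3∣s , nimS[m]≡k

S-avoids : Avoids S nimS
S-avoids m s s∈S = nimS-avoids m (to (T-S-suc⇔3∣ s) s∈S)

[m+t]%n≡[m%n+t]%n : ∀ m t n .{{_ : NonZero n}} → t < n → (m + t) % n ≡ (m % n + t) % n
[m+t]%n≡[m%n+t]%n m t n t<n = trans (%-distribˡ-+ m t n) (cong (λ x → (m % n + x) % n) (m<n⇒m%n≡m t<n))

[m+t]%n-cases : ∀ m t n .{{_ : NonZero n}} → t < n →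
                (m + t) % n ≡ m % n + t ⊎ m % n ≡ (m + t) % n + (n ∸ t)
[m+t]%n-cases m t n t<n with m % n + t <? n
... | yes m%n+t<n = inj₁ (trans ([m+t]%n≡[m%n+t]%n m t n t<n) (m<n⇒m%n≡m m%n+t<n))
... | no m%n+t≮n = inj₂ a≡b+[n∸t]
  where
  open ≡-Reasoning
  a b : ℕ
  a = m % n
  b = a + t ∸ n
  b+n≡a+t : b + n ≡ a + t
  b+n≡a+t = m∸n+n≡m (≮⇒≥ m%n+t≮n)
  b<n : b < n
  b<n = +-cancelʳ-< n b n (subst (_< n + n) (sym b+n≡a+t) (+-mono-< (m%n<n m n) t<n))
  [m+t]%n≡b : (m + t) % n ≡ b
  [m+t]%n≡b = begin
    (m + t) % n ≡⟨ [m+t]%n≡[m%n+t]%n m t n t<n ⟩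
    (a + t) % n ≡⟨ cong (_% n) (sym b+n≡a+t) ⟩
    (b + n) % n ≡⟨ [m+n]%n≡m%n b n ⟩
    b % n       ≡⟨ m<n⇒m%n≡m b<n ⟩
    b           ∎
  a≡b+[n∸t] : a ≡ (m + t) % n + (n ∸ t)
  a≡b+[n∸t] rewrite [m+t]%n≡b = +-cancelʳ-≡ t a (b + (n ∸ t)) (begin
    a + t             ≡⟨ sym b+n≡a+t ⟩
    b + n             ≡⟨ cong (b +_) (sym (m∸n+n≡m (<⇒≤ t<n))) ⟩
    b + (n ∸ t + t)   ≡⟨ sym (+-assoc b (n ∸ t) t) ⟩
    b + (n ∸ t) + t   ∎)

period : ℕ → ℕ
period i = suc (suc (3 * i))

nimSᵢ : ℕ → ℕ → ℕ
nimSᵢ i n = nimS (n % period i)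

T-Sᵢ-suc⇔ : ∀ i s → T (Sᵢ i (suc s)) ⇔ (3 ∣ s × s ≤ 3 * i)
T-Sᵢ-suc⇔ i s = mk⇔
  (λ s∈Sᵢ → let s∈S , s≤bound = to T-∧ s∈Sᵢ in
    to (T-S-suc⇔3∣ s) s∈S , ≤-pred (subst (suc s ≤_) (+-comm (3 * i) 1) (≤ᵇ⇒≤ _ _ s≤bound)))
  (λ (3∣s , s≤3i) →
    from T-∧ (from (T-S-suc⇔3∣ s) 3∣s , ≤⇒≤ᵇ (subst (suc s ≤_) (+-comm 1 (3 * i)) (s≤s s≤3i))))

Sᵢ-covers : ∀ i → Covers (Sᵢ i) (nimSᵢ i)
Sᵢ-covers i n k k< with m , s , m+1+s≡r , 3∣s , nimS[m]≡k ← nimS-covers (n % period i) k k< =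
  m + c * p , s , m+cp+1+s≡n , from (T-Sᵢ-suc⇔ i s) (3∣s , s≤3i) , nimSᵢ[m+cp]≡k
  where
  open ≡-Reasoning
  p c : ℕ
  p = period i
  c = n / p
  m+1+s<p : m + suc s < p
  m+1+s<p = subst (_< p) (sym m+1+s≡r) (m%n<n n p)
  s≤3i : s ≤ 3 * i
  s≤3i = ≤-pred (≤-pred (≤-<-trans (m≤n+m (suc s) m) m+1+s<p))
  m+cp+1+s≡n : m + c * p + suc s ≡ n
  m+cp+1+s≡n = begin
    m + c * p + suc s   ≡⟨ +-assoc m (c * p) (suc s) ⟩
    m + (c * p + suc s) ≡⟨ cong (m +_) (+-comm (c * p) (suc s)) ⟩
    m + (suc s + c * p) ≡⟨ sym (+-assoc m (suc s) (c * p)) ⟩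
    m + suc s + c * p   ≡⟨ cong (_+ c * p) m+1+s≡r ⟩
    n % p + c * p       ≡⟨ sym (m≡m%n+[m/n]*n n p) ⟩
    n                   ∎
  nimSᵢ[m+cp]≡k : nimSᵢ i (m + c * p) ≡ k
  nimSᵢ[m+cp]≡k = begin
    nimS ((m + c * p) % p) ≡⟨ cong nimS ([m+kn]%n≡m%n m c p) ⟩
    nimS (m % p)           ≡⟨ cong nimS (m<n⇒m%n≡m (≤-<-trans (m≤m+n m (suc s)) m+1+s<p)) ⟩
    nimS m                 ≡⟨ nimS[m]≡k ⟩
    k                      ∎

-- A move of length 1 + s that wraps around the period p is, read backwards inside one
-- block, a move of length p − (1 + s) = 1 + (3i − s).
Sᵢ-avoids : ∀ i → Avoids (Sᵢ i) (nimSᵢ i)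
Sᵢ-avoids i m s s∈Sᵢ with 3∣s , s≤3i ← to (T-Sᵢ-suc⇔ i s) s∈Sᵢ
  with [m+t]%n-cases m (suc s) (period i) (s≤s (s≤s s≤3i))
... | inj₁ no-wrap = λ eq → nimS-avoids (m % period i) 3∣s (trans (cong nimS (sym no-wrap)) eq)
... | inj₂ wrap    = λ eq → nimS-avoids r 3∣3i∸s
                              (sym (trans eq (cong nimS (trans wrap (cong (r +_) (+-∸-assoc 1 s≤3i))))))
  where
  r : ℕ
  r = (m + suc s) % period i
  3∣3i∸s : 3 ∣ 3 * i ∸ s
  3∣3i∸s = ∣m+n∣m⇒∣n (subst (3 ∣_) (sym (m+[n∸m]≡n s≤3i)) (m∣m*n i)) 3∣s

length-^ : ∀ u i → length (u ^ i) ≡ i * length u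
length-^ u zero    = refl
length-^ u (suc i) = trans (length-++ u) (cong (length u +_) (length-^ u i))

at-0∷1∷012^ : ∀ i r → r < period i → at (0 ∷ 1 ∷ (0 ∷ 1 ∷ 2 ∷ []) ^ i) r ≡ nimS r
at-0∷1∷012^ i 0             _                = refl
at-0∷1∷012^ i 1             _                = refl
at-0∷1∷012^ i (suc (suc r)) (s≤s (s≤s r<3i)) = at-012^ i r r<3i

nimSᵢ-word : ∀ i n → nimSᵢ i n ≡ ((0 ∷ 1 ∷ ((0 ∷ 1 ∷ 2 ∷ []) ^ i)) ^ω) n
nimSᵢ-word i n = begin
  nimS (n % period i) ≡⟨ sym (at-0∷1∷012^ i (n % period i) (m%n<n n (period i))) ⟩
  at w (n % period i) ≡⟨ cong (λ l → at w (n % suc (suc l))) (sym |012^i|) ⟩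
  at w (n % length w) ∎
  where
  open ≡-Reasoning
  w : List ℕ
  w = 0 ∷ 1 ∷ (0 ∷ 1 ∷ 2 ∷ []) ^ i
  |012^i| : length ((0 ∷ 1 ∷ 2 ∷ []) ^ i) ≡ 3 * i
  |012^i| = trans (length-^ _ i) (*-comm i 3)

proposition5p2 : ((i n : ℕ) → NimSeq (Sᵢ i) n ≡ ((0 ∷ 1 ∷ ((0 ∷ 1 ∷ 2 ∷ []) ^ i)) ^ω) n)
                 × ((n : ℕ) → NimSeq S n ≡ ((0 ∷ 1 ∷ []) · (0 ∷ 1 ∷ 2 ∷ []) ^ω) n)
proposition5p2 =
  (λ i n → trans (SG-unique (Sᵢ i) (nimSᵢ i) (Sᵢ-covers i) (Sᵢ-avoids i) n) (nimSᵢ-word i n)) ,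
  (λ n → trans (SG-unique S nimS S-covers S-avoids n) (nimS-word n))
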